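{- Let $V$ be a finite set with $|V|\ge2$ and $T:\ell^2(V)\to\ell^2(V)$ a self-adjoint operator with $\langle T1_v,1_u\rangle\in\mathbb Z_{\ge0}$ for all $u,v$ and $\mathrm{vol}_T(\{u\})=d>0$ for all $u$, with $T=P_{\rho_1}+\dots+P_{\rho_d}$ for permutations $\rho_i$ of $V$, with $-d$ not an eigenvalue of $T$. Let $\mathcal G$ be a group acting transitively on $V$ whose induced action on $\ell^2(V)$ commutes with $T^2$, such that no index two subgroup of $\mathcal G$ acts transitively on $V$. Let $\psi=\mathfrak h_{T^2}$ and let $A\subseteq V$, $A\ne\emptyset,V$, satisfy $\mathrm{vol}_{T^2}(A)\le\mathrm{vol}_{T^2}(V\setminus A)$ and $\langle T^21_A,1_{V\setminus A}\rangle=\psi\,\mathrm{vol}_{T^2}(A)$. Suppose $\psi<\frac{\mathfrak h_T}{d}$. Then for each $g\in\mathcal G$, at least one of $$\mathrm{vol}_T(A\cap gA)\ge\mathrm{vol}_T(A)\Big(1-\frac{2d\psi}{\mathfrak h_T^2}(1+\mathfrak h_T)\Big),\qquad \mathrm{vol}_T(A\cap gA)\le\mathrm{vol}_T(A)\,\frac{2d\psi}{\mathfrak h_T^2}(1+\mathfrak h_T)$$ holds.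
   Context: $\ell^2(V)$: functions $V\to\mathbb C$ with $\langle f,g\rangle=\sum_vf(v)\overline{g(v)}$; $1_F$ indicator, $1_v=1_{\{v\}}$. $P_\rho f(v)=f(\rho^{ -1}v)$; the induced $\mathcal G$-action is $(g\cdot f)(v)=f(g^{ -1}v)$. $\mathrm{vol}_T(F)=\langle T1_V,1_F\rangle$; $\mathfrak h_T=\min_{F\ne\emptyset,V}\frac{\langle T1_F,1_{V\setminus F}\rangle}{\min\{\mathrm{vol}_T(F),\mathrm{vol}_T(V\setminus F)\}}$, similarly for $T^2$. -}

module Defs where

open import Level using (Level; _⊔_) renaming (suc to lsuc)
open import Data.Bool using (Bool; true; false; if_then_else_)
open import Data.Nat as ℕ using (ℕ; zero; suc)
open import Data.Integer using (+_; -_)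
open import Data.Fin using (Fin; zero; suc; _≟_)
open import Data.Fin.Subset using (Subset; Nonempty; ∁; ⊤; ⁅_⁆)
open import Data.Fin.Permutation using (Permutation′; _⟨$⟩ʳ_)
open import Data.Vec using (lookup; tabulate)
open import Data.Rational as ℚ using (ℚ; 0ℚ; _/_; _÷_; ≢-nonZero)
import Data.Rational.Properties as ℚP
open import Data.Product using (Σ; ∃; _×_; _,_)
open import Data.Sum using (_⊎_)
open import Relation.Nullary using (¬_; yes; no)
open import Relation.Binary.PropositionalEquality using (_≡_; _≢_)
open import Algebra.Bundles using (Group)

sumℕ : ∀ {n} → (Fin n → ℕ) → ℕ
sumℕ {zero} f = 0
sumℕ {suc n} f = f zero ℕ.+ sumℕ (λ i → f (suc i))

sumℚ : ∀ {n} → (Fin n → ℚ) → ℚ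
sumℚ {zero} f = 0ℚ
sumℚ {suc n} f = f zero ℚ.+ sumℚ (λ i → f (suc i))

ℕ→ℚ : ℕ → ℚ
ℕ→ℚ k = (+ k) / 1

-- total division on ℚ: p / q, with the (never used) convention p / 0 = 0
_/′_ : ℚ → ℚ → ℚ
p /′ q with q ℚP.≟ 0ℚ
... | yes _ = 0ℚ
... | no q≢0 = _÷_ p q {{≢-nonZero q≢0}}

-- An operator on ℓ²(Fin n) with natural-number matrix entries:
-- M u v = ⟨M 1_v , 1_u⟩.
Mat : ℕ → Set
Mat n = Fin n → Fin n → ℕ

countFin : ∀ {d} → (Fin d → Bool) → ℕ
countFin {zero} p = 0
countFin {suc d} p = (if p zero then 1 else 0) ℕ.+ countFin (λ i → p (suc i))

eqb : ∀ {n} → Fin n → Fin n → Bool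
eqb u v with u ≟ v
... | yes _ = true
... | no _ = false

-- T = P_{ρ_1} + … + P_{ρ_d}, where P_ρ f(v) = f(ρ⁻¹ v), so P_ρ 1_v = 1_{ρ v}
-- and ⟨T 1_v , 1_u⟩ = #{ i | ρ_i v = u }.
permSum : ∀ {n d} → (Fin d → Permutation′ n) → Mat n
permSum ρ u v = countFin (λ i → eqb (ρ i ⟨$⟩ʳ v) u)

_∘M_ : ∀ {n} → Mat n → Mat n → Mat n
(M ∘M N) u v = sumℕ (λ w → M u w ℕ.* N w v)

SelfAdjoint : ∀ {n} → Mat n → Set
SelfAdjoint M = ∀ u v → M u v ≡ M v u

applyM : ∀ {n} → Mat n → (Fin n → ℚ) → (Fin n → ℚ)
applyM M f u = sumℚ (λ v → ℕ→ℚ (M u v) ℚ.* f v)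

IsEigenvalue : ∀ {n} → Mat n → ℚ → Set
IsEigenvalue M λ′ = Σ (Fin _ → ℚ) λ f → (∃ λ u → f u ≢ 0ℚ) × (∀ u → applyM M f u ≡ λ′ ℚ.* f u)

ind : ∀ {n} → Subset n → Fin n → ℕ → ℕ
ind F u k = if lookup F u then k else 0

-- ⟨M 1_F , 1_G⟩
inner : ∀ {n} → Mat n → Subset n → Subset n → ℕ
inner M F G = sumℕ (λ u → ind G u (sumℕ (λ v → ind F v (M u v))))

vol : ∀ {n} → Mat n → Subset n → ℕ
vol M F = inner M ⊤ F

Proper : ∀ {n} → Subset n → Set
Proper F = Nonempty F × Nonempty (∁ F)

cheegerRatio : ∀ {n} → Mat n → Subset n → ℚ
cheegerRatio M F = ℕ→ℚ (inner M F (∁ F)) /′ ℕ→ℚ (vol M F ℕ.⊓ vol M (∁ F))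

IsCheeger : ∀ {n} → Mat n → ℚ → Set
IsCheeger M h = (∃ λ F → Proper F × h ≡ cheegerRatio M F)
              × (∀ F → Proper F → h ℚ.≤ cheegerRatio M F)

record Action {c ℓ : Level} (G : Group c ℓ) (n : ℕ) : Set (c ⊔ ℓ) where
  open Group G
  field
    act   : Carrier → Fin n → Fin n
    cong  : ∀ {x y} → x ≈ y → ∀ u → act x u ≡ act y u
    act-ε : ∀ u → act ε u ≡ u
    act-∙ : ∀ x y u → act (x ∙ y) u ≡ act x (act y u)

module _ {c ℓ : Level} {G : Group c ℓ} {n : ℕ} (α : Action G n) where
  open Group G
  open Action α

  Transitive : Set c
  Transitive = ∀ u v → ∃ λ g → act g u ≡ v

  actFun : Carrier → (Fin n → ℚ) → (Fin n → ℚ)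
  actFun g f v = f (act (g ⁻¹) v)

  CommutesWith : Mat n → Set c
  CommutesWith M = ∀ g f u → applyM M (actFun g f) u ≡ actFun g (applyM M f) u

  image : Carrier → Subset n → Subset n
  image g A = tabulate (λ u → lookup A (act (g ⁻¹) u))

  -- a subgroup H of index two (G = H ∪ aH for some a ∉ H) acting transitively
  record TransitiveIndexTwoSubgroup : Set (lsuc (c ⊔ ℓ)) where
    field
      H       : Carrier → Set (c ⊔ ℓ)
      H-cong  : ∀ {x y} → x ≈ y → H x → H y
      H-ε     : H ε
      H-∙     : ∀ {x y} → H x → H y → H (x ∙ y)
      H-⁻¹    : ∀ {x} → H x → H (x ⁻¹)
      a       : Carrier
      a∉H     : ¬ H a
      cosets  : ∀ x → H x ⊎ H (a ⁻¹ ∙ x)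
      H-trans : ∀ u v → ∃ λ h → H h × act h u ≡ v

{-# OPTIONS --safe #-}
module Submission where

-- Write z(u) = (T 1_Z)(u) for the number of T-neighbours of u in Z, so that
-- ⟨T² 1_Z , 1_{V∖Z}⟩ = Σ_u (d − z(u)) z(u), and let M(Z) = {u | d ≤ 2 z(u)} be the majority set.
-- Pointwise estimates show that d ⟨T 1_U , 1_{V∖U}⟩ ≤ 2 ⟨T² 1_Z , 1_{V∖Z}⟩ for U = Z ∪ M(Z), and that
-- d vol_T M(Z) ≤ d vol_T Z + 2 ⟨T² 1_Z , 1_{V∖Z}⟩.  For Z = A the right-hand sides are governed by
-- ψ d vol_T A, so the Cheeger inequality for T on A ∪ M(A) forces its complement to be small (A ∪ M(A)
-- itself is too large since ψ d < 𝔥_T), and hence A ∩ M(A) is small as well.  For Z = A ∩ gA the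
-- T²-boundary is at most twice that of A, because T² commutes with the action of g; the Cheeger
-- inequality then makes either Z ∪ M(Z), which contains A ∩ gA, or its complement, which together
-- with A ∩ M(A) covers A ∖ gA, small.  These are the two alternatives.

module RationalArithmetic where
  open import Defs using (ℕ→ℚ; _/′_)
  open import Data.Nat as ℕ using (ℕ)
  import Data.Nat.Properties as ℕP
  open import Data.Nat.Coprimality using (1-coprimeTo) renaming (sym to coprime-sym)
  open import Data.Integer as ℤ using (+_)
  import Data.Integer.Properties as ℤP
  open import Data.Rational
    using (ℚ; mkℚ; _/_; 0ℚ; 1ℚ; _+_; _*_; _-_; -_; _≤_; _<_; *≤*; NonZero; positive; nonNegative; ≢-nonZero; 1/_)
  open import Data.Rational.Properties
  open import Data.Rational.Solver using (module +-*-Solver)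
  open import Data.Sum using (_⊎_; inj₁; inj₂)
  open import Data.Empty using (⊥-elim)
  open import Relation.Nullary using (Dec; yes; no)
  open import Relation.Binary.Definitions using (tri<; tri≈; tri>)
  open import Relation.Binary.PropositionalEquality
  open +-*-Solver

  ℕ→ℚ≡mkℚ : ∀ k → ℕ→ℚ k ≡ mkℚ (+ k) 0 (coprime-sym (1-coprimeTo k))
  ℕ→ℚ≡mkℚ k = normalize-coprime (coprime-sym (1-coprimeTo k))

  ℕ→ℚ-+ : ∀ m n → ℕ→ℚ (m ℕ.+ n) ≡ ℕ→ℚ m + ℕ→ℚ n
  ℕ→ℚ-+ m n = begin
    ℕ→ℚ (m ℕ.+ n)                     ≡⟨ cong (_/ 1) (cong₂ ℤ._+_ (ℤP.*-identityʳ (+ m)) (ℤP.*-identityʳ (+ n))) ⟨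
    (+ m ℤ.* + 1 ℤ.+ + n ℤ.* + 1) / 1 ≡⟨ cong₂ _+_ (ℕ→ℚ≡mkℚ m) (ℕ→ℚ≡mkℚ n) ⟨
    ℕ→ℚ m + ℕ→ℚ n                     ∎
    where open ≡-Reasoning

  ℕ→ℚ-* : ∀ m n → ℕ→ℚ (m ℕ.* n) ≡ ℕ→ℚ m * ℕ→ℚ n
  ℕ→ℚ-* m n = begin
    ℕ→ℚ (m ℕ.* n)     ≡⟨ cong (_/ 1) (ℤP.pos-* m n) ⟩
    (+ m ℤ.* + n) / 1 ≡⟨ cong₂ _*_ (ℕ→ℚ≡mkℚ m) (ℕ→ℚ≡mkℚ n) ⟨
    ℕ→ℚ m * ℕ→ℚ n     ∎
    where open ≡-Reasoning

  ℕ→ℚ-mono-≤ : ∀ {m n} → m ℕ.≤ n → ℕ→ℚ m ≤ ℕ→ℚ n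
  ℕ→ℚ-mono-≤ {m} {n} m≤n rewrite ℕ→ℚ≡mkℚ m | ℕ→ℚ≡mkℚ n =
    *≤* (ℤP.*-monoʳ-≤-nonNeg (+ 1) (ℤ.+≤+ m≤n))

  ℕ→ℚ-cancel-≤ : ∀ {m n} → ℕ→ℚ m ≤ ℕ→ℚ n → m ℕ.≤ n
  ℕ→ℚ-cancel-≤ {m} {n} le rewrite ℕ→ℚ≡mkℚ m | ℕ→ℚ≡mkℚ n with le
  ... | *≤* m*1≤n*1 = ℤP.drop‿+≤+ (subst₂ ℤ._≤_ (ℤP.*-identityʳ (+ m)) (ℤP.*-identityʳ (+ n)) m*1≤n*1)

  ℕ→ℚ-injective : ∀ {m n} → ℕ→ℚ m ≡ ℕ→ℚ n → m ≡ n
  ℕ→ℚ-injective eq = ℕP.≤-antisym (ℕ→ℚ-cancel-≤ (≤-reflexive eq)) (ℕ→ℚ-cancel-≤ (≤-reflexive (sym eq)))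

  ℕ→ℚ-nonNeg : ∀ n → 0ℚ ≤ ℕ→ℚ n
  ℕ→ℚ-nonNeg n = ℕ→ℚ-mono-≤ (ℕ.z≤n {n})

  ℕ→ℚ-pos : ∀ {n} → 0 ℕ.< n → 0ℚ < ℕ→ℚ n
  ℕ→ℚ-pos n>0 = <-≤-trans (positive⁻¹ 1ℚ) (ℕ→ℚ-mono-≤ n>0)

  *-monoˡ-≤-≥0 : ∀ {r p q} → 0ℚ ≤ r → p ≤ q → r * p ≤ r * q
  *-monoˡ-≤-≥0 {r} r≥0 = *-monoˡ-≤-nonNeg r {{nonNegative r≥0}}

  *-monoʳ-≤-≥0 : ∀ {r p q} → 0ℚ ≤ r → p ≤ q → p * r ≤ q * r
  *-monoʳ-≤-≥0 {r} r≥0 = *-monoʳ-≤-nonNeg r {{nonNegative r≥0}}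

  *-cancelˡ-≤->0 : ∀ {r p q} → 0ℚ < r → r * p ≤ r * q → p ≤ q
  *-cancelˡ-≤->0 {r} r>0 = *-cancelˡ-≤-pos r {{positive r>0}}

  *-≥0 : ∀ {p q} → 0ℚ ≤ p → 0ℚ ≤ q → 0ℚ ≤ p * q
  *-≥0 {p} {q} p≥0 q≥0 =
    nonNegative⁻¹ (p * q) {{nonNeg*nonNeg⇒nonNeg p {{nonNegative p≥0}} q {{nonNegative q≥0}}}}

  *->0 : ∀ {p q} → 0ℚ < p → 0ℚ < q → 0ℚ < p * q
  *->0 {p} {q} p>0 q>0 = positive⁻¹ (p * q) {{pos*pos⇒pos p {{positive p>0}} q {{positive q>0}}}}

  >0⇒≢0 : ∀ {q} → 0ℚ < q → q ≢ 0ℚ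
  >0⇒≢0 q>0 q≡0 = <-irrefl (sym q≡0) q>0

  +-cancelʳ-≤ : ∀ {p q} r → p + r ≤ q + r → p ≤ q
  +-cancelʳ-≤ {p} {q} r le = subst₂ _≤_ (cancel p) (cancel q) (+-monoˡ-≤ (- r) le)
    where
    cancel : ∀ t → t + r - r ≡ t
    cancel t = solve 2 (λ t r → t :+ r :- r := t) refl t r

  /′-*-cancel : ∀ p {q} → q ≢ 0ℚ → (p /′ q) * q ≡ p
  /′-*-cancel p {q} q≢0 with q ≟ 0ℚ
  ... | yes q≡0 = ⊥-elim (q≢0 q≡0)
  ... | no q≢0′ = begin
    p * 1/ q * q   ≡⟨ *-assoc p (1/ q) q ⟩
    p * (1/ q * q) ≡⟨ cong (p *_) (*-inverseˡ q) ⟩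
    p * 1ℚ         ≡⟨ *-identityʳ p ⟩
    p              ∎
    where
    open ≡-Reasoning
    instance
      q-nonZero : NonZero q
      q-nonZero = ≢-nonZero q≢0′

  ≤-/′⇒*-≤ : ∀ {h p q} → 0ℚ ≤ p → 0ℚ ≤ q → h ≤ p /′ q → h * q ≤ p
  ≤-/′⇒*-≤ {h} {p} {q} p≥0 q≥0 h≤p/q = case-q (q ≟ 0ℚ)
    where
    case-q : Dec (q ≡ 0ℚ) → h * q ≤ p
    case-q (yes refl) = subst (_≤ p) (sym (*-zeroʳ h)) p≥0
    case-q (no q≢0) = subst (h * q ≤_) (/′-*-cancel p q≢0) (*-monoʳ-≤-≥0 q≥0 h≤p/q)

  /′-nonNeg : ∀ {p q} → 0ℚ ≤ p → 0ℚ ≤ q → 0ℚ ≤ p /′ q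
  /′-nonNeg {p} {q} p≥0 q≥0 with <-cmp 0ℚ q
  ... | tri< q>0 _ _ = *-cancelˡ-≤->0 q>0
    (subst₂ _≤_ (sym (*-zeroʳ q)) (sym (trans (*-comm q (p /′ q)) (/′-*-cancel p (>0⇒≢0 q>0)))) p≥0)
  ... | tri≈ _ refl _ = ≤-refl
  ... | tri> _ _ q<0 = ⊥-elim (<-irrefl refl (<-≤-trans q<0 q≥0))

  /′≤1 : ∀ {p q} → 0ℚ ≤ p → p ≤ q → p /′ q ≤ 1ℚ
  /′≤1 {p} {q} p≥0 p≤q with <-cmp 0ℚ q
  ... | tri< q>0 _ _ = *-cancelˡ-≤->0 q>0
    (subst₂ _≤_ (sym (trans (*-comm q (p /′ q)) (/′-*-cancel p (>0⇒≢0 q>0)))) (sym (*-identityʳ q)) p≤q)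
  ... | tri≈ _ refl _ = nonNegative⁻¹ 1ℚ
  ... | tri> _ _ q<0 = ⊥-elim (<-irrefl refl (<-≤-trans q<0 (≤-trans p≥0 p≤q)))

  <-/′⇒*-< : ∀ {p h q} → 0ℚ < q → p < h /′ q → p * q < h
  <-/′⇒*-< {p} {h} {q} q>0 p<h/q =
    subst (p * q <_) (/′-*-cancel h (>0⇒≢0 q>0)) (*-monoˡ-<-pos q {{positive q>0}} p<h/q)

  -- D = d, h = 𝔥_T and a = vol_T A; s = ψ a is the T²-boundary of A divided by d.
  module OverlapBound (D h ψ a : ℚ) (D≥0 : 0ℚ ≤ D) (ψ≥0 : 0ℚ ≤ ψ) (ψD<h : ψ * D < h)
                      (2ψ≤Dψ : ℕ→ℚ 2 * ψ ≤ D * ψ) (h≤1 : h ≤ 1ℚ) (a>0 : 0ℚ < a) where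

    two four : ℚ
    two = ℕ→ℚ 2
    four = ℕ→ℚ 4

    s : ℚ
    s = ψ * a

    κ : ℚ
    κ = ((two * D * ψ) /′ (h * h)) * (1ℚ + h)

    N : ℚ
    N = two * D * ψ * a * (1ℚ + h)

    h>0 : 0ℚ < h
    h>0 = ≤-<-trans (*-≥0 ψ≥0 D≥0) ψD<h

    h≥0 : 0ℚ ≤ h
    h≥0 = <⇒≤ h>0

    1+h≥0 : 0ℚ ≤ 1ℚ + h
    1+h≥0 = +-mono-≤ (nonNegative⁻¹ 1ℚ) h≥0

    2s≥0 : 0ℚ ≤ two * s
    2s≥0 = *-≥0 (nonNegative⁻¹ two) (*-≥0 ψ≥0 (<⇒≤ a>0))

    h≤1+h : h ≤ 1ℚ + h
    h≤1+h = subst (_≤ 1ℚ + h) (+-identityˡ h) (+-monoˡ-≤ h (nonNegative⁻¹ 1ℚ))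

    *2s≤N : ∀ {r} → r ≤ two * (1ℚ + h) → r * (two * s) ≤ N
    *2s≤N {r} r≤2[1+h] = begin
      r * (two * s)                 ≤⟨ *-monoʳ-≤-≥0 2s≥0 r≤2[1+h] ⟩
      two * (1ℚ + h) * (two * s)    ≡⟨ solve 3 (λ h a ψ → con two :* (con 1ℚ :+ h) :* (con two :* (ψ :* a))
                                                      := con two :* (con 1ℚ :+ h) :* a :* (con two :* ψ)) refl h a ψ ⟩
      two * (1ℚ + h) * a * (two * ψ) ≤⟨ *-monoˡ-≤-≥0 (*-≥0 (*-≥0 (nonNegative⁻¹ two) 1+h≥0) (<⇒≤ a>0)) 2ψ≤Dψ ⟩
      two * (1ℚ + h) * a * (D * ψ)   ≡⟨ solve 4 (λ D h a ψ → con two :* (con 1ℚ :+ h) :* a :* (D :* ψ)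
                                                       := con two :* D :* ψ :* a :* (con 1ℚ :+ h)) refl D h a ψ ⟩
      N                              ∎
      where open ≤-Reasoning

    h*h*z≤N⇒z≤aκ : ∀ {z} → h * h * z ≤ N → z ≤ a * κ
    h*h*z≤N⇒z≤aκ {z} h*h*z≤N = *-cancelˡ-≤->0 h*h>0 (subst (h * h * z ≤_) N≡h*h*aκ h*h*z≤N)
      where
      h*h>0 : 0ℚ < h * h
      h*h>0 = *->0 h>0 h>0
      K : ℚ
      K = (two * D * ψ) /′ (h * h)
      N≡h*h*aκ : N ≡ h * h * (a * κ)
      N≡h*h*aκ = begin
        two * D * ψ * a * (1ℚ + h)   ≡⟨ cong (λ t → t * a * (1ℚ + h)) (/′-*-cancel (two * D * ψ) (>0⇒≢0 h*h>0)) ⟨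
        K * (h * h) * a * (1ℚ + h)   ≡⟨ solve 3 (λ K h a → K :* (h :* h) :* a :* (con 1ℚ :+ h)
                                                     := h :* h :* (a :* (K :* (con 1ℚ :+ h)))) refl K h a ⟩
        h * h * (a * κ)              ∎
        where open ≡-Reasoning

    -- A side of measure at least a cannot satisfy the Cheeger bound, as h a ≤ 2 ψ a ≤ D ψ a < h a.
    far-side-small : ∀ {u m} → a ≤ u → h * u ≤ two * s ⊎ h * m ≤ two * s → h * m ≤ two * s
    far-side-small a≤u (inj₂ hm≤2s) = hm≤2s
    far-side-small {u} a≤u (inj₁ hu≤2s) = ⊥-elim (<-irrefl refl (begin-strict
      h * a       ≤⟨ *-monoˡ-≤-≥0 h≥0 a≤u ⟩
      h * u       ≤⟨ hu≤2s ⟩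
      two * s     ≡⟨ *-assoc two ψ a ⟨
      two * ψ * a ≤⟨ *-monoʳ-≤-≥0 (<⇒≤ a>0) 2ψ≤Dψ ⟩
      D * ψ * a   <⟨ *-monoˡ-<-pos a {{positive a>0}} (subst (_< h) (*-comm ψ D) ψD<h) ⟩
      h * a       ∎))
      where open ≤-Reasoning

    overlap-small : ∀ {c p m} → c + a ≤ p + m → p ≤ a + two * s → h * m ≤ two * s →
                    h * c ≤ two * s * (1ℚ + h)
    overlap-small {c} {p} {m} c+a≤p+m p≤a+2s hm≤2s = begin
      h * c                   ≤⟨ *-monoˡ-≤-≥0 h≥0 c≤2s+m ⟩
      h * (two * s + m)       ≡⟨ *-distribˡ-+ h (two * s) m ⟩
      h * (two * s) + h * m   ≤⟨ +-monoʳ-≤ (h * (two * s)) hm≤2s ⟩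
      h * (two * s) + two * s ≡⟨ solve 2 (λ h t → h :* t :+ t := t :* (con 1ℚ :+ h)) refl h (two * s) ⟩
      two * s * (1ℚ + h)      ∎
      where
      open ≤-Reasoning
      c≤2s+m : c ≤ two * s + m
      c≤2s+m = +-cancelʳ-≤ a (begin
        c + a               ≤⟨ c+a≤p+m ⟩
        p + m               ≤⟨ +-monoˡ-≤ m p≤a+2s ⟩
        a + two * s + m     ≡⟨ solve 3 (λ a t m → a :+ t :+ m := t :+ m :+ a) refl a (two * s) m ⟩
        two * s + m + a     ∎)

    inside-small : ∀ {x u} → x ≤ u → h * u ≤ four * s → x ≤ a * κ
    inside-small {x} {u} x≤u hu≤4s = h*h*z≤N⇒z≤aκ (begin
      h * h * x           ≡⟨ *-assoc h h x ⟩
      h * (h * x)         ≤⟨ *-monoˡ-≤-≥0 h≥0 (*-monoˡ-≤-≥0 h≥0 x≤u) ⟩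
      h * (h * u)         ≤⟨ *-monoˡ-≤-≥0 h≥0 hu≤4s ⟩
      h * (four * s)      ≡⟨ solve 2 (λ h s → h :* (con four :* s) := con two :* h :* (con two :* s)) refl h s ⟩
      two * h * (two * s) ≤⟨ *2s≤N (*-monoˡ-≤-≥0 (nonNegative⁻¹ two) h≤1+h) ⟩
      N                   ∎)
      where open ≤-Reasoning

    outside-small : ∀ {y m c} → y ≤ m + c → h * c ≤ two * s * (1ℚ + h) → h * m ≤ four * s → y ≤ a * κ
    outside-small {y} {m} {c} y≤m+c hc≤ hm≤4s = h*h*z≤N⇒z≤aκ (begin
      h * h * y
        ≡⟨ *-assoc h h y ⟩
      h * (h * y)
        ≤⟨ *-monoˡ-≤-≥0 h≥0 (*-monoˡ-≤-≥0 h≥0 y≤m+c) ⟩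
      h * (h * (m + c))
        ≡⟨ cong (h *_) (*-distribˡ-+ h m c) ⟩
      h * (h * m + h * c)
        ≤⟨ *-monoˡ-≤-≥0 h≥0 (+-mono-≤ hm≤4s hc≤) ⟩
      h * (four * s + two * s * (1ℚ + h))
        ≡⟨ solve 2 (λ h s → h :* (con four :* s :+ con two :* s :* (con 1ℚ :+ h))
            := (con two :* h :+ h :* (con 1ℚ :+ h)) :* (con two :* s)) refl h s ⟩
      (two * h + h * (1ℚ + h)) * (two * s)
        ≤⟨ *2s≤N 2h+h[1+h]≤2[1+h] ⟩
      N ∎)
      where
      open ≤-Reasoning
      2h+h[1+h]≤2[1+h] : two * h + h * (1ℚ + h) ≤ two * (1ℚ + h)
      2h+h[1+h]≤2[1+h] = begin
        two * h + h * (1ℚ + h)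
          ≤⟨ +-monoʳ-≤ (two * h) (*-monoʳ-≤-≥0 1+h≥0 h≤1) ⟩
        two * h + 1ℚ * (1ℚ + h)
          ≡⟨ solve 1 (λ h → con two :* h :+ con 1ℚ :* (con 1ℚ :+ h) := con two :* h :+ con 1ℚ :+ h) refl h ⟩
        two * h + 1ℚ + h
          ≤⟨ +-monoʳ-≤ (two * h + 1ℚ) h≤1 ⟩
        two * h + 1ℚ + 1ℚ
          ≡⟨ solve 1 (λ h → con two :* h :+ con 1ℚ :+ con 1ℚ := con two :* (con 1ℚ :+ h)) refl h ⟩
        two * (1ℚ + h) ∎

    complement-large : ∀ {x y} → a ≡ x + y → y ≤ a * κ → a * (1ℚ - κ) ≤ x
    complement-large {x} {y} a≡x+y y≤aκ = begin
      a * (1ℚ - κ) ≡⟨ solve 2 (λ a κ → a :* (con 1ℚ :- κ) := a :- a :* κ) refl a κ ⟩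
      a - a * κ    ≤⟨ +-monoʳ-≤ a (neg-antimono-≤ y≤aκ) ⟩
      a - y        ≡⟨ cong (_- y) a≡x+y ⟩
      x + y - y    ≡⟨ solve 2 (λ x y → x :+ y :- y := x) refl x y ⟩
      x            ∎
      where open ≤-Reasoning

    dichotomy : ∀ {x y c p uA mA uX mX} →
      a ≡ x + y → c + a ≤ p + mA → p ≤ a + two * s →
      a ≤ uA → h * uA ≤ two * s ⊎ h * mA ≤ two * s →
      x ≤ uX → y ≤ mX + c → h * uX ≤ four * s ⊎ h * mX ≤ four * s →
      a * (1ℚ - κ) ≤ x ⊎ x ≤ a * κ
    dichotomy _ _ _ _ _ x≤uX _ (inj₁ huX≤4s) = inj₂ (inside-small x≤uX huX≤4s)
    dichotomy {c = c} a≡x+y c+a≤p+mA p≤a+2s a≤uA A-sides _ y≤mX+c (inj₂ hmX≤4s) =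
      inj₁ (complement-large a≡x+y (outside-small y≤mX+c hc≤ hmX≤4s))
      where
      hc≤ : h * c ≤ two * s * (1ℚ + h)
      hc≤ = overlap-small c+a≤p+mA p≤a+2s (far-side-small a≤uA A-sides)

open import Defs
open import Level using (Level)
open import Data.Nat as ℕ using (ℕ; _≤_; _<_)
open import Data.Integer using (+_; -_)
open import Data.Fin using (Fin)
open import Data.Fin.Subset using (Subset; ∁; _∩_; ⁅_⁆)
open import Data.Fin.Permutation using (Permutation′)
open import Data.Rational as ℚ using (ℚ; _/_; 1ℚ)
open import Data.Rational using (0ℚ)
open import Data.Product using (_×_)
open import Data.Sum using (_⊎_)
open import Relation.Nullary using (¬_)
open import Relation.Binary.PropositionalEquality using (_≡_)
open import Algebra.Bundles using (Group)

open import Function using (_∘_; flip)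
open import Data.Nat using (zero; suc; _+_; _*_; _∸_; _⊓_; z≤n; s≤s; _≤?_)
import Data.Nat.Properties as ℕP
open import Data.Nat.Solver using (module +-*-Solver)
import Data.Rational.Solver as ℚ-Solver
open import Data.Bool using (true; false; not; _∧_; _∨_; if_then_else_)
open import Data.Fin using (zero; suc)
open import Data.Fin.Properties using (suc-injective)
open import Data.Fin.Subset using (_∪_; ⊤; ⊥; Nonempty; _∈_; _⊆_)
open import Data.Fin.Subset.Properties
  using ( ∈⊤; ⊆⊤; Empty-unique; nonempty?; _∈?_; x∈⁅x⁆; x∈⁅y⁆⇒x≡y; p⊆p∪q; p∩q⊆p
        ; x∈p∩q⁺; x∈p∩q⁻; x∈p∪q⁺; x∈p∪q⁻; x∈∁p⇒x∉p; x∉p⇒x∈∁p)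
import Data.Rational.Properties as ℚP
open import Data.Fin.Permutation using (permutation; _⟨$⟩ʳ_)
open import Data.Vec using (lookup; tabulate)
import Data.Vec.Properties as VecP
open import Data.Product using (_,_; proj₂)
open import Data.Sum using (inj₁; inj₂; [_,_]′)
import Data.Sum as ⊎
open import Data.Empty using (⊥-elim)
open import Relation.Nullary using (Dec; yes; no)
open import Relation.Nullary.Decidable using (⌊_⌋)
open import Relation.Binary.PropositionalEquality
  using (refl; sym; trans; cong; cong₂; subst; subst₂; _≢_; module ≡-Reasoning)
open import Algebra.Properties.Semiring.Sum ℕP.+-*-semiring
  using (sum; sum-cong-≗; ∑-distrib-+; ∑-comm; sum-permute; *-distribˡ-sum)

open RationalArithmetic

-- Finite sums

sumℕ≡sum : ∀ {n} (f : Fin n → ℕ) → sumℕ f ≡ sum f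
sumℕ≡sum {zero} f = refl
sumℕ≡sum {suc n} f = cong (_+_ (f zero)) (sumℕ≡sum (f ∘ suc))

sumℕ-cong : ∀ {n} {f g : Fin n → ℕ} → (∀ i → f i ≡ g i) → sumℕ f ≡ sumℕ g
sumℕ-cong {f = f} {g} f≗g = trans (sumℕ≡sum f) (trans (sum-cong-≗ f≗g) (sym (sumℕ≡sum g)))

sumℕ-+ : ∀ {n} (f g : Fin n → ℕ) → sumℕ (λ i → f i + g i) ≡ sumℕ f + sumℕ g
sumℕ-+ f g = trans (sumℕ≡sum (λ i → f i + g i)) (trans (∑-distrib-+ f g) (sym (cong₂ _+_ (sumℕ≡sum f) (sumℕ≡sum g))))

sumℕ-*ˡ : ∀ {n} k (f : Fin n → ℕ) → sumℕ (λ i → k * f i) ≡ k * sumℕ f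
sumℕ-*ˡ k f = trans (sumℕ≡sum (λ i → k * f i)) (trans (sym (*-distribˡ-sum k f)) (cong (k *_) (sym (sumℕ≡sum f))))

sumℕ-*ʳ : ∀ {n} k (f : Fin n → ℕ) → sumℕ (λ i → f i * k) ≡ sumℕ f * k
sumℕ-*ʳ k f = trans (sumℕ-cong (λ i → ℕP.*-comm (f i) k)) (trans (sumℕ-*ˡ k f) (ℕP.*-comm k (sumℕ f)))

sumℕ-comm : ∀ {m n} (f : Fin m → Fin n → ℕ) →
  sumℕ (λ i → sumℕ (λ j → f i j)) ≡ sumℕ (λ j → sumℕ (λ i → f i j))
sumℕ-comm f = trans (double≡ f) (trans (∑-comm f) (sym (double≡ (flip f))))
  where
  double≡ : ∀ {m n} (f : Fin m → Fin n → ℕ) → sumℕ (λ i → sumℕ (f i)) ≡ sum (λ i → sum (f i))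
  double≡ f = trans (sumℕ≡sum (λ i → sumℕ (f i))) (sum-cong-≗ (λ i → sumℕ≡sum (f i)))

sumℕ-permute : ∀ {n} (f : Fin n → ℕ) (π : Permutation′ n) → sumℕ f ≡ sumℕ (f ∘ (π ⟨$⟩ʳ_))
sumℕ-permute f π = trans (sumℕ≡sum f) (trans (sum-permute f π) (sym (sumℕ≡sum (f ∘ (π ⟨$⟩ʳ_)))))

sumℕ-zero : ∀ n → sumℕ {n} (λ _ → 0) ≡ 0
sumℕ-zero zero = refl
sumℕ-zero (suc n) = sumℕ-zero n

sumℕ-mono : ∀ {n} {f g : Fin n → ℕ} → (∀ i → f i ≤ g i) → sumℕ f ≤ sumℕ g
sumℕ-mono {zero} f≤g = z≤n
sumℕ-mono {suc n} f≤g = ℕP.+-mono-≤ (f≤g zero) (sumℕ-mono (f≤g ∘ suc))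

term≤sumℕ : ∀ {n} (f : Fin n → ℕ) i → f i ≤ sumℕ f
term≤sumℕ f zero = ℕP.m≤m+n _ _
term≤sumℕ f (suc i) = ℕP.≤-trans (term≤sumℕ (f ∘ suc) i) (ℕP.m≤n+m _ (f zero))

sumℕ-single : ∀ {n} (f : Fin n → ℕ) i → (∀ j → j ≢ i → f j ≡ 0) → sumℕ f ≡ f i
sumℕ-single {suc n} f zero f≡0 =
  trans (cong (_+_ (f zero)) (trans (sumℕ-cong (λ j → f≡0 (suc j) (λ ()))) (sumℕ-zero n))) (ℕP.+-identityʳ _)
sumℕ-single {suc n} f (suc i) f≡0 =
  trans (cong (_+ sumℕ (f ∘ suc)) (f≡0 zero (λ ())))
        (sumℕ-single (f ∘ suc) i (λ j j≢i → f≡0 (suc j) (j≢i ∘ suc-injective)))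

sumℚ-cong : ∀ {n} {f g : Fin n → ℚ} → (∀ i → f i ≡ g i) → sumℚ f ≡ sumℚ g
sumℚ-cong {zero} _ = refl
sumℚ-cong {suc n} f≗g = cong₂ ℚ._+_ (f≗g zero) (sumℚ-cong (f≗g ∘ suc))

ℕ→ℚ-sumℕ : ∀ {n} (f : Fin n → ℕ) → ℕ→ℚ (sumℕ f) ≡ sumℚ (ℕ→ℚ ∘ f)
ℕ→ℚ-sumℕ {zero} f = refl
ℕ→ℚ-sumℕ {suc n} f = trans (ℕ→ℚ-+ (f zero) (sumℕ (f ∘ suc))) (cong (ℚ._+_ (ℕ→ℚ (f zero))) (ℕ→ℚ-sumℕ (f ∘ suc)))

-- Indicators, volumes and boundaries

lookup-∁ : ∀ {n} (F : Subset n) u → lookup (∁ F) u ≡ not (lookup F u)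
lookup-∁ F u = VecP.lookup-map u not F

lookup-∩ : ∀ {n} (F G : Subset n) u → lookup (F ∩ G) u ≡ lookup F u ∧ lookup G u
lookup-∩ F G u = VecP.lookup-zipWith _∧_ u F G

lookup-∪ : ∀ {n} (F G : Subset n) u → lookup (F ∪ G) u ≡ lookup F u ∨ lookup G u
lookup-∪ F G u = VecP.lookup-zipWith _∨_ u F G

ind-∈ : ∀ {n} {F : Subset n} {u} k → u ∈ F → ind F u k ≡ k
ind-∈ k u∈F rewrite VecP.[]=⇒lookup u∈F = refl

ind-⊥ : ∀ {n} u k → ind (⊥ {n}) u k ≡ 0
ind-⊥ u k rewrite VecP.lookup-replicate u false = refl

ind-≤ : ∀ {n} (F : Subset n) u k → ind F u k ≤ k
ind-≤ F u k with lookup F u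
... | true = ℕP.≤-refl
... | false = z≤n

ind-mono : ∀ {n} {F G : Subset n} → F ⊆ G → ∀ u k → ind F u k ≤ ind G u k
ind-mono {F = F} F⊆G u k with lookup F u in u∈F
... | true rewrite VecP.[]=⇒lookup (F⊆G (VecP.lookup⇒[]= u F u∈F)) = ℕP.≤-refl
... | false = z≤n

ind-sum : ∀ {n m} (F : Subset n) u (f : Fin m → ℕ) → ind F u (sumℕ f) ≡ sumℕ (λ v → ind F u (f v))
ind-sum {m = m} F u f with lookup F u
... | true = refl
... | false = sym (sumℕ-zero m)

ind-*ˡ : ∀ {n} (F : Subset n) u a b → ind F u (a * b) ≡ ind F u a * b
ind-*ˡ F u a b with lookup F u
... | true = refl
... | false = refl

ind-*ʳ : ∀ {n} (F : Subset n) u a b → ind F u (a * b) ≡ a * ind F u b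
ind-*ʳ F u a b with lookup F u
... | true = refl
... | false = sym (ℕP.*-zeroʳ a)

ind-comm : ∀ {n} (F G : Subset n) u v k → ind G u (ind F v k) ≡ ind F v (ind G u k)
ind-comm F G u v k with lookup G u | lookup F v
... | true | true = refl
... | true | false = refl
... | false | true = refl
... | false | false = refl

ind-∉ : ∀ {n} {F : Subset n} {u} k → ¬ (u ∈ F) → ind F u k ≡ 0
ind-∉ {F = F} {u} k u∉F with lookup F u in eq
... | true = ⊥-elim (u∉F (VecP.lookup⇒[]= u F eq))
... | false = refl

ind+ind-∁ : ∀ {n} (F : Subset n) u k → ind F u k + ind (∁ F) u k ≡ ind ⊤ u k
ind+ind-∁ F u k rewrite lookup-∁ F u | ind-∈ k (∈⊤ {x = u}) with lookup F u
... | true = ℕP.+-identityʳ k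
... | false = refl

applyInd : ∀ {n} → Mat n → Subset n → Fin n → ℕ
applyInd M F u = sumℕ (λ v → ind F v (M u v))

cut : ∀ {n} → Mat n → Subset n → ℕ
cut M F = inner M F (∁ F)

applyInd+applyInd-∁ : ∀ {n} (M : Mat n) Z u → applyInd M Z u + applyInd M (∁ Z) u ≡ applyInd M ⊤ u
applyInd+applyInd-∁ M Z u =
  trans (sym (sumℕ-+ (λ v → ind Z v (M u v)) (λ v → ind (∁ Z) v (M u v)))) (sumℕ-cong (λ v → ind+ind-∁ Z v (M u v)))

applyInd-mono : ∀ {n} (M : Mat n) {Z Z′} → Z ⊆ Z′ → ∀ u → applyInd M Z u ≤ applyInd M Z′ u
applyInd-mono M Z⊆Z′ u = sumℕ-mono (λ v → ind-mono Z⊆Z′ v (M u v))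

vol-+ : ∀ {n} (M : Mat n) F G →
  vol M F + vol M G ≡ sumℕ (λ u → ind F u (applyInd M ⊤ u) + ind G u (applyInd M ⊤ u))
vol-+ M F G = sym (sumℕ-+ (λ u → ind F u (applyInd M ⊤ u)) (λ u → ind G u (applyInd M ⊤ u)))

vol-mono : ∀ {n} (M : Mat n) {F G} → F ⊆ G → vol M F ≤ vol M G
vol-mono M F⊆G = sumℕ-mono (λ u → ind-mono F⊆G u (applyInd M ⊤ u))

vol-∪ : ∀ {n} (M : Mat n) F G → vol M (F ∪ G) ≤ vol M F + vol M G
vol-∪ M F G = ℕP.≤-trans (sumℕ-mono (λ u → pointwise u (applyInd M ⊤ u))) (ℕP.≤-reflexive (sym (vol-+ M F G)))
  where
  pointwise : ∀ u k → ind (F ∪ G) u k ≤ ind F u k + ind G u k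
  pointwise u k rewrite lookup-∪ F G u with lookup F u | lookup G u
  ... | true | _ = ℕP.m≤m+n k _
  ... | false | true = ℕP.≤-refl
  ... | false | false = z≤n

vol-split : ∀ {n} (M : Mat n) F C → vol M (F ∩ C) + vol M (F ∩ ∁ C) ≡ vol M F
vol-split M F C = trans (vol-+ M (F ∩ C) (F ∩ ∁ C)) (sumℕ-cong (λ u → pointwise u (applyInd M ⊤ u)))
  where
  pointwise : ∀ u k → ind (F ∩ C) u k + ind (F ∩ ∁ C) u k ≡ ind F u k
  pointwise u k rewrite lookup-∩ F C u | lookup-∩ F (∁ C) u | lookup-∁ C u with lookup F u | lookup C u
  ... | true | true = ℕP.+-identityʳ k
  ... | true | false = refl
  ... | false | _ = refl

vol-∪+vol-∩ : ∀ {n} (M : Mat n) F G → vol M (F ∪ G) + vol M (F ∩ G) ≡ vol M F + vol M G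
vol-∪+vol-∩ M F G = trans (vol-+ M (F ∪ G) (F ∩ G))
  (trans (sumℕ-cong (λ u → pointwise u (applyInd M ⊤ u))) (sym (vol-+ M F G)))
  where
  pointwise : ∀ u k → ind (F ∪ G) u k + ind (F ∩ G) u k ≡ ind F u k + ind G u k
  pointwise u k rewrite lookup-∪ F G u | lookup-∩ F G u with lookup F u | lookup G u
  ... | true | true = refl
  ... | true | false = refl
  ... | false | true = ℕP.+-identityʳ k
  ... | false | false = refl

vol-∁ : ∀ {n} (M : Mat n) F → vol M F + vol M (∁ F) ≡ vol M ⊤
vol-∁ M F = trans (vol-+ M F (∁ F)) (sumℕ-cong (λ u → ind+ind-∁ F u (applyInd M ⊤ u)))

vol-empty : ∀ {n} (M : Mat n) F → ¬ Nonempty F → vol M F ≡ 0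
vol-empty {n} M F F-empty rewrite Empty-unique F-empty =
  trans (sumℕ-cong (λ u → ind-⊥ u (applyInd M ⊤ u))) (sumℕ-zero n)

vol[A∩P]+vol[A]≤vol[P]+vol[∁[A∪P]] : ∀ {n} (M : Mat n) A P → vol M A ≤ vol M (∁ A) →
  vol M (A ∩ P) + vol M A ≤ vol M P + vol M (∁ (A ∪ P))
vol[A∩P]+vol[A]≤vol[P]+vol[∁[A∪P]] M A P a≤ā = ℕP.+-cancelˡ-≤ u (c + a) (p + m) (begin
  u + (c + a)  ≡⟨ ℕP.+-assoc u c a ⟨
  u + c + a    ≡⟨ cong (_+ a) (vol-∪+vol-∩ M A P) ⟩
  a + p + a    ≤⟨ ℕP.+-monoʳ-≤ (a + p) a≤ā ⟩
  a + p + ā    ≡⟨ solve 3 (λ a p ā → a :+ p :+ ā := p :+ (a :+ ā)) refl a p ā ⟩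
  p + (a + ā)  ≡⟨ cong (_+_ p) (trans (vol-∁ M A) (sym (vol-∁ M (A ∪ P)))) ⟩
  p + (u + m)  ≡⟨ solve 3 (λ p u m → p :+ (u :+ m) := u :+ (p :+ m)) refl p u m ⟩
  u + (p + m)  ∎)
  where
  open ℕP.≤-Reasoning
  open +-*-Solver
  u c a p m ā : ℕ
  u = vol M (A ∪ P)
  c = vol M (A ∩ P)
  a = vol M A
  p = vol M P
  m = vol M (∁ (A ∪ P))
  ā = vol M (∁ A)

vol-⁅⁆ : ∀ {n} (M : Mat n) u → vol M ⁅ u ⁆ ≡ applyInd M ⊤ u
vol-⁅⁆ M u = trans (sumℕ-single (λ w → ind ⁅ u ⁆ w (applyInd M ⊤ w)) u outside) (ind-∈ (applyInd M ⊤ u) (x∈⁅x⁆ u))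
  where
  outside : ∀ w → w ≢ u → ind ⁅ u ⁆ w (applyInd M ⊤ w) ≡ 0
  outside w w≢u = ind-∉ (applyInd M ⊤ w) (w≢u ∘ x∈⁅y⁆⇒x≡y u)

A∩∁C⊆∁[[A∩C]∪P]∪[A∩Q] : ∀ {n} (A C : Subset n) {P Q} → P ⊆ Q → A ∩ ∁ C ⊆ ∁ ((A ∩ C) ∪ P) ∪ (A ∩ Q)
A∩∁C⊆∁[[A∩C]∪P]∪[A∩Q] A C {P} P⊆Q {u} u∈A∩∁C with x∈p∩q⁻ A (∁ C) u∈A∩∁C | u ∈? P
... | u∈A , _ | yes u∈P = x∈p∪q⁺ (inj₂ (x∈p∩q⁺ (u∈A , P⊆Q u∈P)))
... | _ , u∈∁C | no u∉P = x∈p∪q⁺ (inj₁ (x∉p⇒x∈∁p ([ u∉A∩C , u∉P ]′ ∘ x∈p∪q⁻ (A ∩ C) P)))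
  where
  u∉A∩C : ¬ (u ∈ A ∩ C)
  u∉A∩C = x∈∁p⇒x∉p u∈∁C ∘ proj₂ ∘ x∈p∩q⁻ A C

inner≡Σ² : ∀ {n} (M : Mat n) F G → inner M F G ≡ sumℕ (λ u → sumℕ (λ v → ind G u (ind F v (M u v))))
inner≡Σ² M F G = sumℕ-cong (λ u → ind-sum G u (λ v → ind F v (M u v)))

inner-≤-pointwise : ∀ {n} (M : Mat n) {F G F₁ G₁ F₂ G₂ : Subset n} →
  (∀ u v k → ind G u (ind F v k) ≤ ind G₁ u (ind F₁ v k) + ind G₂ u (ind F₂ v k)) →
  inner M F G ≤ inner M F₁ G₁ + inner M F₂ G₂
inner-≤-pointwise {n} M {F} {G} {F₁} {G₁} {F₂} {G₂} le = begin
  inner M F G                                          ≡⟨ inner≡Σ² M F G ⟩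
  sumℕ (λ u → sumℕ (λ v → ind G u (ind F v (M u v))))  ≤⟨ sumℕ-mono (λ u → sumℕ-mono (λ v → le u v (M u v))) ⟩
  sumℕ (λ u → sumℕ (λ v → t₁ u v + t₂ u v))           ≡⟨ sumℕ-cong (λ u → sumℕ-+ (t₁ u) (t₂ u)) ⟩
  sumℕ (λ u → sumℕ (t₁ u) + sumℕ (t₂ u))              ≡⟨ sumℕ-+ (sumℕ ∘ t₁) (sumℕ ∘ t₂) ⟩
  sumℕ (sumℕ ∘ t₁) + sumℕ (sumℕ ∘ t₂)                 ≡⟨ cong₂ _+_ (inner≡Σ² M F₁ G₁) (inner≡Σ² M F₂ G₂) ⟨
  inner M F₁ G₁ + inner M F₂ G₂                        ∎
  where
  open ℕP.≤-Reasoning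
  t₁ t₂ : Fin n → Fin n → ℕ
  t₁ u v = ind G₁ u (ind F₁ v (M u v))
  t₂ u v = ind G₂ u (ind F₂ v (M u v))

cut-∩ : ∀ {n} (M : Mat n) A C → cut M (A ∩ C) ≤ cut M A + cut M C
cut-∩ M A C = inner-≤-pointwise M {A ∩ C} {∁ (A ∩ C)} {A} {∁ A} {C} {∁ C} pointwise
  where
  pointwise : ∀ u v k → ind (∁ (A ∩ C)) u (ind (A ∩ C) v k) ≤ ind (∁ A) u (ind A v k) + ind (∁ C) u (ind C v k)
  pointwise u v k rewrite lookup-∁ (A ∩ C) u | lookup-∩ A C u | lookup-∩ A C v | lookup-∁ A u | lookup-∁ C u
    with lookup A u | lookup C u | lookup A v | lookup C v
  ... | true  | true  | _     | _     = z≤n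
  ... | true  | false | true  | true  = ℕP.≤-refl
  ... | true  | false | true  | false = z≤n
  ... | true  | false | false | _     = z≤n
  ... | false | _     | true  | true  = ℕP.m≤m+n k _
  ... | false | _     | true  | false = z≤n
  ... | false | _     | false | _     = z≤n

cut-∪ : ∀ {n} (M : Mat n) Z W → cut M (Z ∪ W) ≤ inner M Z (∁ W) + inner M W (∁ Z)
cut-∪ M Z W = inner-≤-pointwise M {Z ∪ W} {∁ (Z ∪ W)} {Z} {∁ W} {W} {∁ Z} pointwise
  where
  pointwise : ∀ u v k → ind (∁ (Z ∪ W)) u (ind (Z ∪ W) v k) ≤ ind (∁ W) u (ind Z v k) + ind (∁ Z) u (ind W v k)
  pointwise u v k rewrite lookup-∁ (Z ∪ W) u | lookup-∪ Z W u | lookup-∪ Z W v | lookup-∁ W u | lookup-∁ Z u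
    with lookup Z u | lookup W u | lookup Z v | lookup W v
  ... | true  | _     | _     | _     = z≤n
  ... | false | true  | _     | _     = z≤n
  ... | false | false | true  | _     = ℕP.m≤m+n k _
  ... | false | false | false | true  = ℕP.≤-refl
  ... | false | false | false | false = z≤n

applyInd-∘ : ∀ {n} (M N : Mat n) F u → applyInd (M ∘M N) F u ≡ sumℕ (λ w → M u w * applyInd N F w)
applyInd-∘ M N F u = begin
  sumℕ (λ v → ind F v (sumℕ (λ w → M u w * N w v)))
    ≡⟨ sumℕ-cong (λ v → ind-sum F v (λ w → M u w * N w v)) ⟩
  sumℕ (λ v → sumℕ (λ w → ind F v (M u w * N w v)))
    ≡⟨ sumℕ-cong (λ v → sumℕ-cong (λ w → ind-*ʳ F v (M u w) (N w v))) ⟩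
  sumℕ (λ v → sumℕ (λ w → M u w * ind F v (N w v)))
    ≡⟨ sumℕ-comm (λ v w → M u w * ind F v (N w v)) ⟩
  sumℕ (λ w → sumℕ (λ v → M u w * ind F v (N w v)))
    ≡⟨ sumℕ-cong (λ w → sumℕ-*ˡ (M u w) (λ v → ind F v (N w v))) ⟩
  sumℕ (λ w → M u w * applyInd N F w) ∎
  where open ≡-Reasoning

module Symmetric {n} (M : Mat n) (M-sym : SelfAdjoint M) where

  inner-sym : ∀ F G → inner M F G ≡ inner M G F
  inner-sym F G = begin
    inner M F G                                          ≡⟨ inner≡Σ² M F G ⟩
    sumℕ (λ u → sumℕ (λ v → ind G u (ind F v (M u v))))  ≡⟨ sumℕ-comm (λ u v → ind G u (ind F v (M u v))) ⟩
    sumℕ (λ v → sumℕ (λ u → ind G u (ind F v (M u v))))  ≡⟨ sumℕ-cong (λ v → sumℕ-cong (λ u → swap u v)) ⟩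
    sumℕ (λ v → sumℕ (λ u → ind F v (ind G u (M v u))))  ≡⟨ inner≡Σ² M G F ⟨
    inner M G F                                          ∎
    where
    open ≡-Reasoning
    swap : ∀ u v → ind G u (ind F v (M u v)) ≡ ind F v (ind G u (M v u))
    swap u v = trans (ind-comm F G u v (M u v)) (cong (λ t → ind F v (ind G u t)) (M-sym u v))

  sum-applyInd : ∀ F → sumℕ (applyInd M F) ≡ vol M F
  sum-applyInd F = begin
    sumℕ (λ w → sumℕ (λ v → ind F v (M w v)))  ≡⟨ sumℕ-comm (λ w v → ind F v (M w v)) ⟩
    sumℕ (λ v → sumℕ (λ w → ind F v (M w v)))  ≡⟨ sumℕ-cong (λ v → ind-sum F v (λ w → M w v)) ⟨
    sumℕ (λ v → ind F v (sumℕ (λ w → M w v)))  ≡⟨ sumℕ-cong (λ v → cong (ind F v) (sumℕ-cong (column≡row v))) ⟩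
    vol M F                                     ∎
    where
    open ≡-Reasoning
    column≡row : ∀ v w → M w v ≡ ind ⊤ w (M v w)
    column≡row v w = trans (M-sym w v) (sym (ind-∈ (M v w) (∈⊤ {x = w})))

  inner≤vol : ∀ F G → inner M F G ≤ vol M F
  inner≤vol F G = ℕP.≤-trans (sumℕ-mono (λ u → ind-≤ G u (applyInd M F u))) (ℕP.≤-reflexive (sum-applyInd F))

  cut≤vol⊓vol-∁ : ∀ F → cut M F ≤ vol M F ⊓ vol M (∁ F)
  cut≤vol⊓vol-∁ F = ℕP.⊓-glb (inner≤vol F (∁ F)) (subst (_≤ vol M (∁ F)) (inner-sym (∁ F) F) (inner≤vol (∁ F) F))

  cheeger≤1 : ∀ {h} → IsCheeger M h → h ℚ.≤ 1ℚ
  cheeger≤1 ((F , _ , h≡ratio) , _) =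
    subst (ℚ._≤ 1ℚ) (sym h≡ratio) (/′≤1 (ℕ→ℚ-nonNeg (cut M F)) (ℕ→ℚ-mono-≤ (cut≤vol⊓vol-∁ F)))

  inner-∘ : ∀ (N : Mat n) F G → inner (M ∘M N) F G ≡ sumℕ (λ w → applyInd M G w * applyInd N F w)
  inner-∘ N F G = begin
    sumℕ (λ u → ind G u (applyInd (M ∘M N) F u))
      ≡⟨ sumℕ-cong (λ u → cong (ind G u) (applyInd-∘ M N F u)) ⟩
    sumℕ (λ u → ind G u (sumℕ (λ w → M u w * y w)))
      ≡⟨ sumℕ-cong (λ u → ind-sum G u (λ w → M u w * y w)) ⟩
    sumℕ (λ u → sumℕ (λ w → ind G u (M u w * y w)))
      ≡⟨ sumℕ-cong (λ u → sumℕ-cong (λ w → ind-*ˡ G u (M u w) (y w))) ⟩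
    sumℕ (λ u → sumℕ (λ w → ind G u (M u w) * y w))
      ≡⟨ sumℕ-comm (λ u w → ind G u (M u w) * y w) ⟩
    sumℕ (λ w → sumℕ (λ u → ind G u (M u w) * y w))
      ≡⟨ sumℕ-cong (λ w → sumℕ-*ʳ (y w) (λ u → ind G u (M u w))) ⟩
    sumℕ (λ w → sumℕ (λ u → ind G u (M u w)) * y w)
      ≡⟨ sumℕ-cong (λ w → cong (_* y w) (sumℕ-cong (λ u → cong (ind G u) (M-sym u w)))) ⟩
    sumℕ (λ w → applyInd M G w * y w) ∎
    where
    open ≡-Reasoning
    y : Fin n → ℕ
    y = applyInd N F

-- Cheeger constants

cheeger-nonNeg : ∀ {n} {M : Mat n} {h} → IsCheeger M h → 0ℚ ℚ.≤ h
cheeger-nonNeg {M = M} ((F , _ , h≡ratio) , _) =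
  subst (0ℚ ℚ.≤_) (sym h≡ratio) (/′-nonNeg (ℕ→ℚ-nonNeg (cut M F)) (ℕ→ℚ-nonNeg (vol M F ⊓ vol M (∁ F))))

cheeger-bound : ∀ {n} {M : Mat n} {h} → IsCheeger M h → ∀ U →
  h ℚ.* ℕ→ℚ (vol M U ⊓ vol M (∁ U)) ℚ.≤ ℕ→ℚ (cut M U)
cheeger-bound {M = M} {h} (_ , h≤ratio) U = by-cases (nonempty? U) (nonempty? (∁ U))
  where
  goal : Set
  goal = h ℚ.* ℕ→ℚ (vol M U ⊓ vol M (∁ U)) ℚ.≤ ℕ→ℚ (cut M U)
  degenerate : vol M U ⊓ vol M (∁ U) ≡ 0 → goal
  degenerate min≡0 rewrite min≡0 = subst (ℚ._≤ ℕ→ℚ (cut M U)) (sym (ℚP.*-zeroʳ h)) (ℕ→ℚ-nonNeg (cut M U))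
  by-cases : Dec (Nonempty U) → Dec (Nonempty (∁ U)) → goal
  by-cases (yes U≢∅) (yes ∁U≢∅) =
    ≤-/′⇒*-≤ (ℕ→ℚ-nonNeg (cut M U)) (ℕ→ℚ-nonNeg (vol M U ⊓ vol M (∁ U))) (h≤ratio U (U≢∅ , ∁U≢∅))
  by-cases (no U≡∅) _ = degenerate (cong (_⊓ vol M (∁ U)) (vol-empty M U U≡∅))
  by-cases (yes _) (no ∁U≡∅) = degenerate (trans (cong (vol M U ⊓_) (vol-empty M (∁ U) ∁U≡∅)) (ℕP.⊓-zeroʳ (vol M U)))

*-⊓-cases : ∀ {h e} m m′ → h ℚ.* ℕ→ℚ (m ⊓ m′) ℚ.≤ e → h ℚ.* ℕ→ℚ m ℚ.≤ e ⊎ h ℚ.* ℕ→ℚ m′ ℚ.≤ e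
*-⊓-cases {h} {e} m m′ le with ℕP.⊓-sel m m′
... | inj₁ m⊓m′≡m = inj₁ (subst (λ t → h ℚ.* ℕ→ℚ t ℚ.≤ e) m⊓m′≡m le)
... | inj₂ m⊓m′≡m′ = inj₂ (subst (λ t → h ℚ.* ℕ→ℚ t ℚ.≤ e) m⊓m′≡m′ le)

-- The pointwise estimates for the majority set

d*[d∸z]≤2*[d∸z]*z : ∀ d z → d ≤ 2 * z → d * (d ∸ z) ≤ 2 * ((d ∸ z) * z)
d*[d∸z]≤2*[d∸z]*z d z d≤2z = begin
  d * (d ∸ z)       ≤⟨ ℕP.*-monoˡ-≤ (d ∸ z) d≤2z ⟩
  2 * z * (d ∸ z)   ≡⟨ solve 2 (λ z e → con 2 :* z :* e := con 2 :* (e :* z)) refl z (d ∸ z) ⟩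
  2 * ((d ∸ z) * z) ∎
  where
  open ℕP.≤-Reasoning
  open +-*-Solver

d*z≤2*[d∸z]*z : ∀ d z → ¬ (d ≤ 2 * z) → d * z ≤ 2 * ((d ∸ z) * z)
d*z≤2*[d∸z]*z d z d≰2z = begin
  d * z             ≤⟨ ℕP.*-monoˡ-≤ z d≤2[d∸z] ⟩
  2 * (d ∸ z) * z   ≡⟨ ℕP.*-assoc 2 (d ∸ z) z ⟩
  2 * ((d ∸ z) * z) ∎
  where
  open ℕP.≤-Reasoning
  z+z≤d : z + z ≤ d
  z+z≤d = subst (_≤ d) (cong (_+_ z) (ℕP.+-identityʳ z)) (ℕP.<⇒≤ (ℕP.≰⇒> d≰2z))
  d≤2[d∸z] : d ≤ 2 * (d ∸ z)
  d≤2[d∸z] = begin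
    d                 ≡⟨ ℕP.m+[n∸m]≡n (ℕP.≤-trans (ℕP.m≤m+n z z) z+z≤d) ⟨
    z + (d ∸ z)       ≤⟨ ℕP.+-monoˡ-≤ (d ∸ z) (ℕP.m+n≤o⇒m≤o∸n z z+z≤d) ⟩
    (d ∸ z) + (d ∸ z) ≡⟨ cong (_+_ (d ∸ z)) (ℕP.+-identityʳ (d ∸ z)) ⟨
    2 * (d ∸ z)       ∎

d*d≤d*z+2*[d∸z]*z : ∀ d z → d ≤ 2 * z → z ≤ d → d * d ≤ d * z + 2 * ((d ∸ z) * z)
d*d≤d*z+2*[d∸z]*z d z d≤2z z≤d = begin
  d * d                       ≡⟨ cong (d *_) (ℕP.m+[n∸m]≡n z≤d) ⟨
  d * (z + (d ∸ z))           ≡⟨ ℕP.*-distribˡ-+ d z (d ∸ z) ⟩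
  d * z + d * (d ∸ z)         ≤⟨ ℕP.+-monoʳ-≤ (d * z) (d*[d∸z]≤2*[d∸z]*z d z d≤2z) ⟩
  d * z + 2 * ((d ∸ z) * z)   ∎
  where open ℕP.≤-Reasoning

-- (d ∸ z) * z vanishes unless both factors are positive, and then d ≥ 2.
2*[d∸z]*z≤d*[d∸z]*z : ∀ d z → 2 * ((d ∸ z) * z) ≤ d * ((d ∸ z) * z)
2*[d∸z]*z≤d*[d∸z]*z (suc (suc d)) z = ℕP.*-monoˡ-≤ ((suc (suc d) ∸ z) * z) {2} {suc (suc d)} (s≤s (s≤s z≤n))
2*[d∸z]*z≤d*[d∸z]*z 0 z rewrite ℕP.0∸n≡0 z = z≤n
2*[d∸z]*z≤d*[d∸z]*z 1 zero = z≤n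
2*[d∸z]*z≤d*[d∸z]*z 1 (suc z) rewrite ℕP.0∸n≡0 z = z≤n

module Regular {n} (d : ℕ) (T : Mat n) (T-sym : SelfAdjoint T) (T-regular : ∀ u → applyInd T ⊤ u ≡ d) where

  open Symmetric T T-sym

  T² : Mat n
  T² = T ∘M T

  vol-regular : ∀ F → vol T F ≡ sumℕ (λ u → ind F u d)
  vol-regular F = sumℕ-cong (λ u → cong (ind F u) (T-regular u))

  applyInd≤d : ∀ Z u → applyInd T Z u ≤ d
  applyInd≤d Z u = subst (applyInd T Z u ≤_) (T-regular u) (applyInd-mono T {Z} ⊆⊤ u)

  applyInd-∁ : ∀ Z u → applyInd T (∁ Z) u ≡ d ∸ applyInd T Z u
  applyInd-∁ Z u = begin
    applyInd T (∁ Z) u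
      ≡⟨ ℕP.m+n∸m≡n (applyInd T Z u) (applyInd T (∁ Z) u) ⟨
    applyInd T Z u + applyInd T (∁ Z) u ∸ applyInd T Z u
      ≡⟨ cong (_∸ applyInd T Z u) (trans (applyInd+applyInd-∁ T Z u) (T-regular u)) ⟩
    d ∸ applyInd T Z u ∎
    where open ≡-Reasoning

  vol-T² : ∀ F → vol T² F ≡ d * vol T F
  vol-T² F = begin
    vol T² F                                     ≡⟨ inner-∘ T ⊤ F ⟩
    sumℕ (λ u → applyInd T F u * applyInd T ⊤ u) ≡⟨ sumℕ-cong (λ u → cong (applyInd T F u *_) (T-regular u)) ⟩
    sumℕ (λ u → applyInd T F u * d)              ≡⟨ sumℕ-*ʳ d (applyInd T F) ⟩
    sumℕ (applyInd T F) * d                      ≡⟨ cong (_* d) (sum-applyInd F) ⟩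
    vol T F * d                                  ≡⟨ ℕP.*-comm (vol T F) d ⟩
    d * vol T F                                  ∎
    where open ≡-Reasoning

  cut-T² : ∀ Z → cut T² Z ≡ sumℕ (λ u → (d ∸ applyInd T Z u) * applyInd T Z u)
  cut-T² Z = trans (inner-∘ T Z (∁ Z)) (sumℕ-cong (λ u → cong (_* applyInd T Z u) (applyInd-∁ Z u)))

  2*cut-T²≤d*cut-T² : ∀ Z → 2 * cut T² Z ≤ d * cut T² Z
  2*cut-T²≤d*cut-T² Z = begin
    2 * cut T² Z                        ≡⟨ cong (2 *_) (cut-T² Z) ⟩
    2 * sumℕ (λ u → (d ∸ z u) * z u)    ≡⟨ sumℕ-*ˡ 2 (λ u → (d ∸ z u) * z u) ⟨
    sumℕ (λ u → 2 * ((d ∸ z u) * z u))  ≤⟨ sumℕ-mono (λ u → 2*[d∸z]*z≤d*[d∸z]*z d (z u)) ⟩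
    sumℕ (λ u → d * ((d ∸ z u) * z u))  ≡⟨ sumℕ-*ˡ d (λ u → (d ∸ z u) * z u) ⟩
    d * sumℕ (λ u → (d ∸ z u) * z u)    ≡⟨ cong (d *_) (cut-T² Z) ⟨
    d * cut T² Z                        ∎
    where
    open ℕP.≤-Reasoning
    z : Fin n → ℕ
    z = applyInd T Z

  majority : Subset n → Subset n
  majority Z = tabulate (λ u → ⌊ d ≤? 2 * applyInd T Z u ⌋)

  lookup-majority : ∀ Z u → lookup (majority Z) u ≡ ⌊ d ≤? 2 * applyInd T Z u ⌋
  lookup-majority Z u = VecP.lookup∘tabulate (λ u → ⌊ d ≤? 2 * applyInd T Z u ⌋) u

  majority-mono : ∀ {Z Z′} → Z ⊆ Z′ → majority Z ⊆ majority Z′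
  majority-mono {Z} {Z′} Z⊆Z′ {u} u∈ =
    VecP.lookup⇒[]= u (majority Z′) (lookup-true (VecP.[]=⇒lookup u∈))
    where
    lookup-true : lookup (majority Z) u ≡ true → lookup (majority Z′) u ≡ true
    lookup-true eq rewrite lookup-majority Z u | lookup-majority Z′ u
      with d ≤? 2 * applyInd T Z u | d ≤? 2 * applyInd T Z′ u
    ... | yes _ | yes _ = refl
    ... | yes d≤2z | no d≰2z′ = ⊥-elim (d≰2z′ (ℕP.≤-trans d≤2z (ℕP.*-monoʳ-≤ 2 (applyInd-mono T Z⊆Z′ u))))

  closure : Subset n → Subset n
  closure Z = Z ∪ majority Z

  d*cut-closure≤2*cut-T² : ∀ Z → d * cut T (closure Z) ≤ 2 * cut T² Z
  d*cut-closure≤2*cut-T² Z = begin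
    d * cut T (Z ∪ W)
      ≤⟨ ℕP.*-monoʳ-≤ d (cut-∪ T Z W) ⟩
    d * (inner T Z (∁ W) + inner T W (∁ Z))
      ≡⟨ cong (λ t → d * (inner T Z (∁ W) + t)) (inner-sym W (∁ Z)) ⟩
    d * (inner T Z (∁ W) + inner T (∁ Z) W)
      ≡⟨ cong (d *_) (sumℕ-+ (λ u → ind (∁ W) u (z u)) (λ u → ind W u (applyInd T (∁ Z) u))) ⟨
    d * sumℕ (λ u → ind (∁ W) u (z u) + ind W u (applyInd T (∁ Z) u))
      ≡⟨ cong (d *_) (sumℕ-cong (λ u → cong (_+_ (ind (∁ W) u (z u))) (cong (ind W u) (applyInd-∁ Z u)))) ⟩
    d * sumℕ smaller-side
      ≡⟨ sumℕ-*ˡ d smaller-side ⟨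
    sumℕ (λ u → d * smaller-side u)
      ≤⟨ sumℕ-mono pointwise ⟩
    sumℕ (λ u → 2 * ((d ∸ z u) * z u))
      ≡⟨ sumℕ-*ˡ 2 (λ u → (d ∸ z u) * z u) ⟩
    2 * sumℕ (λ u → (d ∸ z u) * z u)
      ≡⟨ cong (2 *_) (cut-T² Z) ⟨
    2 * cut T² Z ∎
    where
    open ℕP.≤-Reasoning
    W : Subset n
    W = majority Z
    z : Fin n → ℕ
    z = applyInd T Z
    smaller-side : Fin n → ℕ
    smaller-side u = ind (∁ W) u (z u) + ind W u (d ∸ z u)
    pointwise : ∀ u → d * smaller-side u ≤ 2 * ((d ∸ z u) * z u)
    pointwise u rewrite lookup-∁ W u | lookup-majority Z u with d ≤? 2 * z u
    ... | yes d≤2z = d*[d∸z]≤2*[d∸z]*z d (z u) d≤2z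
    ... | no d≰2z = subst (_≤ 2 * ((d ∸ z u) * z u)) (cong (d *_) (sym (ℕP.+-identityʳ (z u))))
                          (d*z≤2*[d∸z]*z d (z u) d≰2z)

  d*vol-majority≤d*vol+2*cut-T² : ∀ Z → d * vol T (majority Z) ≤ d * vol T Z + 2 * cut T² Z
  d*vol-majority≤d*vol+2*cut-T² Z = begin
    d * vol T W
      ≡⟨ cong (d *_) (vol-regular W) ⟩
    d * sumℕ (λ u → ind W u d)
      ≡⟨ sumℕ-*ˡ d (λ u → ind W u d) ⟨
    sumℕ (λ u → d * ind W u d)
      ≡⟨ sumℕ-cong (λ u → ind-*ʳ W u d d) ⟨
    sumℕ (λ u → ind W u (d * d))
      ≤⟨ sumℕ-mono pointwise ⟩
    sumℕ (λ u → d * z u + 2 * ((d ∸ z u) * z u))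
      ≡⟨ sumℕ-+ (λ u → d * z u) (λ u → 2 * ((d ∸ z u) * z u)) ⟩
    sumℕ (λ u → d * z u) + sumℕ (λ u → 2 * ((d ∸ z u) * z u))
      ≡⟨ cong₂ _+_ (sumℕ-*ˡ d z) (sumℕ-*ˡ 2 (λ u → (d ∸ z u) * z u)) ⟩
    d * sumℕ z + 2 * sumℕ (λ u → (d ∸ z u) * z u)
      ≡⟨ cong₂ (λ s t → d * s + 2 * t) (sum-applyInd Z) (sym (cut-T² Z)) ⟩
    d * vol T Z + 2 * cut T² Z ∎
    where
    open ℕP.≤-Reasoning
    W : Subset n
    W = majority Z
    z : Fin n → ℕ
    z = applyInd T Z
    pointwise : ∀ u → ind W u (d * d) ≤ d * z u + 2 * ((d ∸ z u) * z u)
    pointwise u rewrite lookup-majority Z u with d ≤? 2 * z u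
    ... | yes d≤2z = d*d≤d*z+2*[d∸z]*z d (z u) d≤2z (applyInd≤d Z u)
    ... | no _ = z≤n

  vol-pos : 0 < d → ∀ {F} → Nonempty F → 0 < vol T F
  vol-pos d>0 {F} (u , u∈F) = ℕP.<-≤-trans d>0 (begin
    d                      ≡⟨ ind-∈ d u∈F ⟨
    ind F u d              ≤⟨ term≤sumℕ (λ v → ind F v d) u ⟩
    sumℕ (λ v → ind F v d) ≡⟨ vol-regular F ⟨
    vol T F                ∎)
    where open ℕP.≤-Reasoning

  closure-cheeger : 0 < d → ∀ {h} → IsCheeger T h → ∀ Z B → ℕ→ℚ (2 * cut T² Z) ℚ.≤ ℕ→ℚ d ℚ.* B →
    h ℚ.* ℕ→ℚ (vol T (closure Z)) ℚ.≤ B ⊎ h ℚ.* ℕ→ℚ (vol T (∁ (closure Z))) ℚ.≤ B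
  closure-cheeger d>0 {h} h-cheeger Z B 2cut≤dB =
    ⊎.map (bound (vol T (closure Z))) (bound (vol T (∁ (closure Z))))
          (*-⊓-cases {h} (vol T (closure Z)) (vol T (∁ (closure Z))) (cheeger-bound h-cheeger (closure Z)))
    where
    bound : ∀ m → h ℚ.* ℕ→ℚ m ℚ.≤ ℕ→ℚ (cut T (closure Z)) → h ℚ.* ℕ→ℚ m ℚ.≤ B
    bound m hm≤cut = *-cancelˡ-≤->0 (ℕ→ℚ-pos d>0) (begin
      ℕ→ℚ d ℚ.* (h ℚ.* ℕ→ℚ m)            ≤⟨ *-monoˡ-≤-≥0 (ℕ→ℚ-nonNeg d) hm≤cut ⟩
      ℕ→ℚ d ℚ.* ℕ→ℚ (cut T (closure Z))  ≡⟨ ℕ→ℚ-* d (cut T (closure Z)) ⟨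
      ℕ→ℚ (d * cut T (closure Z))        ≤⟨ ℕ→ℚ-mono-≤ (d*cut-closure≤2*cut-T² Z) ⟩
      ℕ→ℚ (2 * cut T² Z)                 ≤⟨ 2cut≤dB ⟩
      ℕ→ℚ d ℚ.* B                        ∎)
      where open ℚP.≤-Reasoning

  2*ψ≤d*ψ : ∀ {ψ} A → 0 < vol T² A → ℕ→ℚ (cut T² A) ≡ ψ ℚ.* ℕ→ℚ (vol T² A) → ℕ→ℚ 2 ℚ.* ψ ℚ.≤ ℕ→ℚ d ℚ.* ψ
  2*ψ≤d*ψ {ψ} A V>0 cut≡ψV = *-cancelˡ-≤->0 (ℕ→ℚ-pos V>0) (begin
    V ℚ.* (ℕ→ℚ 2 ℚ.* ψ)    ≡⟨ ℚP.*-comm V (ℕ→ℚ 2 ℚ.* ψ) ⟩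
    ℕ→ℚ 2 ℚ.* ψ ℚ.* V      ≡⟨ ℚP.*-assoc (ℕ→ℚ 2) ψ V ⟩
    ℕ→ℚ 2 ℚ.* (ψ ℚ.* V)    ≡⟨ trans (ℕ→ℚ-* 2 (cut T² A)) (cong (ℚ._*_ (ℕ→ℚ 2)) cut≡ψV) ⟨
    ℕ→ℚ (2 * cut T² A)     ≤⟨ ℕ→ℚ-mono-≤ (2*cut-T²≤d*cut-T² A) ⟩
    ℕ→ℚ (d * cut T² A)     ≡⟨ trans (ℕ→ℚ-* d (cut T² A)) (cong (ℚ._*_ (ℕ→ℚ d)) cut≡ψV) ⟩
    ℕ→ℚ d ℚ.* (ψ ℚ.* V)    ≡⟨ ℚP.*-assoc (ℕ→ℚ d) ψ V ⟨
    ℕ→ℚ d ℚ.* ψ ℚ.* V      ≡⟨ ℚP.*-comm (ℕ→ℚ d ℚ.* ψ) V ⟩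
    V ℚ.* (ℕ→ℚ d ℚ.* ψ)    ∎)
    where
    open ℚP.≤-Reasoning
    V : ℚ
    V = ℕ→ℚ (vol T² A)

  vol≤vol-∁ : 0 < d → ∀ A → vol T² A ≤ vol T² (∁ A) → vol T A ≤ vol T (∁ A)
  vol≤vol-∁ d>0 A vol²A≤vol²∁A =
    ℕP.*-cancelˡ-≤ d {{ℕ.>-nonZero d>0}} (subst₂ _≤_ (vol-T² A) (vol-T² (∁ A)) vol²A≤vol²∁A)

  vol[A∩∁C]≤ : ∀ A C → vol T (A ∩ ∁ C) ≤ vol T (∁ (closure (A ∩ C))) + vol T (A ∩ majority A)
  vol[A∩∁C]≤ A C = ℕP.≤-trans (vol-mono T (A∩∁C⊆∁[[A∩C]∪P]∪[A∩Q] A C (majority-mono (p∩q⊆p A C))))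
                              (vol-∪ T (∁ (closure (A ∩ C))) (A ∩ majority A))

  2*cut-T²-∩≤4*cut-T² : ∀ A C → cut T² C ≡ cut T² A → 2 * cut T² (A ∩ C) ≤ 4 * cut T² A
  2*cut-T²-∩≤4*cut-T² A C cut²C≡cut²A = begin
    2 * cut T² (A ∩ C)            ≤⟨ ℕP.*-monoʳ-≤ 2 (cut-∩ T² A C) ⟩
    2 * (cut T² A + cut T² C)     ≡⟨ cong (λ t → 2 * (cut T² A + t)) cut²C≡cut²A ⟩
    2 * (cut T² A + cut T² A)     ≡⟨ solve 1 (λ t → con 2 :* (t :+ t) := con 4 :* t) refl (cut T² A) ⟩
    4 * cut T² A                  ∎
    where
    open ℕP.≤-Reasoning
    open +-*-Solver

  k*cut-T²≡d*[k*ψ*vol] : ∀ ψ A → ℕ→ℚ (cut T² A) ≡ ψ ℚ.* ℕ→ℚ (vol T² A) →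
    ∀ k → ℕ→ℚ (k * cut T² A) ≡ ℕ→ℚ d ℚ.* (ℕ→ℚ k ℚ.* (ψ ℚ.* ℕ→ℚ (vol T A)))
  k*cut-T²≡d*[k*ψ*vol] ψ A cut²A≡ψvol²A k = begin
    ℕ→ℚ (k * cut T² A)       ≡⟨ ℕ→ℚ-* k (cut T² A) ⟩
    K ℚ.* ℕ→ℚ (cut T² A)     ≡⟨ cong (ℚ._*_ K) (trans cut²A≡ψvol²A (cong (ℚ._*_ ψ) vol²A≡Da)) ⟩
    K ℚ.* (ψ ℚ.* (D ℚ.* a))  ≡⟨ solve 4 (λ K ψ D a → K :* (ψ :* (D :* a)) := D :* (K :* (ψ :* a))) refl K ψ D a ⟩
    D ℚ.* (K ℚ.* (ψ ℚ.* a))  ∎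
    where
    open ≡-Reasoning
    open ℚ-Solver.+-*-Solver
    K D a : ℚ
    K = ℕ→ℚ k
    D = ℕ→ℚ d
    a = ℕ→ℚ (vol T A)
    vol²A≡Da : ℕ→ℚ (vol T² A) ≡ D ℚ.* a
    vol²A≡Da = trans (cong ℕ→ℚ (vol-T² A)) (ℕ→ℚ-* d (vol T A))

  vol-majority≤vol+2ψ*vol : 0 < d → ∀ ψ A → ℕ→ℚ (cut T² A) ≡ ψ ℚ.* ℕ→ℚ (vol T² A) →
    ℕ→ℚ (vol T (majority A)) ℚ.≤ ℕ→ℚ (vol T A) ℚ.+ ℕ→ℚ 2 ℚ.* (ψ ℚ.* ℕ→ℚ (vol T A))
  vol-majority≤vol+2ψ*vol d>0 ψ A cut²A≡ψvol²A = *-cancelˡ-≤->0 (ℕ→ℚ-pos d>0) (begin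
    D ℚ.* ℕ→ℚ (vol T (majority A))
      ≡⟨ ℕ→ℚ-* d (vol T (majority A)) ⟨
    ℕ→ℚ (d * vol T (majority A))
      ≤⟨ ℕ→ℚ-mono-≤ (d*vol-majority≤d*vol+2*cut-T² A) ⟩
    ℕ→ℚ (d * vol T A + 2 * cut T² A)
      ≡⟨ trans (ℕ→ℚ-+ (d * vol T A) (2 * cut T² A))
          (cong₂ ℚ._+_ (ℕ→ℚ-* d (vol T A)) (k*cut-T²≡d*[k*ψ*vol] ψ A cut²A≡ψvol²A 2)) ⟩
    D ℚ.* a ℚ.+ D ℚ.* (ℕ→ℚ 2 ℚ.* (ψ ℚ.* a))
      ≡⟨ ℚP.*-distribˡ-+ D a (ℕ→ℚ 2 ℚ.* (ψ ℚ.* a)) ⟨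
    D ℚ.* (a ℚ.+ ℕ→ℚ 2 ℚ.* (ψ ℚ.* a)) ∎)
    where
    open ℚP.≤-Reasoning
    D a : ℚ
    D = ℕ→ℚ d
    a = ℕ→ℚ (vol T A)

  overlap-dichotomy : 0 < d → ∀ {h ψ} → IsCheeger T h → 0ℚ ℚ.≤ ψ →
    ∀ A C → Nonempty A → vol T² A ≤ vol T² (∁ A) →
    ℕ→ℚ (cut T² A) ≡ ψ ℚ.* ℕ→ℚ (vol T² A) → ψ ℚ.< h /′ ℕ→ℚ d → cut T² C ≡ cut T² A →
    let κ = ((ℕ→ℚ 2 ℚ.* ℕ→ℚ d ℚ.* ψ) /′ (h ℚ.* h)) ℚ.* (1ℚ ℚ.+ h)
        a = ℕ→ℚ (vol T A)
        x = ℕ→ℚ (vol T (A ∩ C))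
    in (a ℚ.* (1ℚ ℚ.- κ) ℚ.≤ x) ⊎ (x ℚ.≤ a ℚ.* κ)
  overlap-dichotomy d>0 {h} {ψ} h-cheeger ψ≥0 A C A≢∅ vol²A≤vol²∁A cut²A≡ψvol²A ψ<h/d cut²C≡cut²A =
    dichotomy {volℚ X} {volℚ (A ∩ ∁ C)} {volℚ (A ∩ majority A)} {volℚ (majority A)}
              {volℚ (closure A)} {volℚ (∁ (closure A))} {volℚ (closure X)} {volℚ (∁ (closure X))}
      (trans (cong ℕ→ℚ (sym (vol-split T A C))) (ℕ→ℚ-+ (vol T X) (vol T (A ∩ ∁ C))))
      (subst₂ ℚ._≤_ (ℕ→ℚ-+ (vol T (A ∩ majority A)) (vol T A)) (ℕ→ℚ-+ (vol T (majority A)) (vol T (∁ (closure A))))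
        (ℕ→ℚ-mono-≤ (vol[A∩P]+vol[A]≤vol[P]+vol[∁[A∪P]] T A (majority A) (vol≤vol-∁ d>0 A vol²A≤vol²∁A))))
      (vol-majority≤vol+2ψ*vol d>0 ψ A cut²A≡ψvol²A)
      (ℕ→ℚ-mono-≤ (vol-mono T {A} {closure A} (p⊆p∪q (majority A))))
      (closure-cheeger d>0 h-cheeger A (two ℚ.* s) (ℚP.≤-reflexive (k*cut-T²≡d*[k*ψ*vol] ψ A cut²A≡ψvol²A 2)))
      (ℕ→ℚ-mono-≤ (vol-mono T {X} {closure X} (p⊆p∪q (majority X))))
      (subst (ℚ._≤_ (volℚ (A ∩ ∁ C))) (ℕ→ℚ-+ (vol T (∁ (closure X))) (vol T (A ∩ majority A)))
        (ℕ→ℚ-mono-≤ (vol[A∩∁C]≤ A C)))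
      (closure-cheeger d>0 h-cheeger X (four ℚ.* s)
        (subst (ℚ._≤_ (ℕ→ℚ (2 * cut T² X))) (k*cut-T²≡d*[k*ψ*vol] ψ A cut²A≡ψvol²A 4)
          (ℕ→ℚ-mono-≤ (2*cut-T²-∩≤4*cut-T² A C cut²C≡cut²A))))
    where
    X : Subset n
    X = A ∩ C
    volℚ : Subset n → ℚ
    volℚ F = ℕ→ℚ (vol T F)
    vol²A>0 : 0 < vol T² A
    vol²A>0 = subst (0 <_) (sym (vol-T² A)) (ℕP.*-mono-< d>0 (vol-pos d>0 A≢∅))
    open OverlapBound (ℕ→ℚ d) h ψ (volℚ A) (ℕ→ℚ-nonNeg d) ψ≥0
      (<-/′⇒*-< (ℕ→ℚ-pos d>0) ψ<h/d) (2*ψ≤d*ψ A vol²A>0 cut²A≡ψvol²A) (cheeger≤1 h-cheeger)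
      (ℕ→ℚ-pos (vol-pos d>0 A≢∅))

module Invariance {c ℓ} {G : Group c ℓ} {n} (α : Action G n) where

  open Group G using (_⁻¹; inverseˡ; inverseʳ)
  open Action α using (act; act-ε; act-∙) renaming (cong to act-cong)

  act⁻¹-act : ∀ g u → act (g ⁻¹) (act g u) ≡ u
  act⁻¹-act g u = trans (sym (act-∙ (g ⁻¹) g u)) (trans (act-cong (inverseˡ g) u) (act-ε u))

  act-act⁻¹ : ∀ g u → act g (act (g ⁻¹) u) ≡ u
  act-act⁻¹ g u = trans (sym (act-∙ g (g ⁻¹) u)) (trans (act-cong (inverseʳ g) u) (act-ε u))

  sumℕ-act : ∀ g (f : Fin n → ℕ) → sumℕ f ≡ sumℕ (f ∘ act g)
  sumℕ-act g f = sumℕ-permute f (permutation (act g) (act (g ⁻¹)) (act-act⁻¹ g) (act⁻¹-act g))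

  lookup-image : ∀ g F u → lookup (image α g F) u ≡ lookup F (act (g ⁻¹) u)
  lookup-image g F = VecP.lookup∘tabulate (λ u → lookup F (act (g ⁻¹) u))

  ∁-image : ∀ g F → ∁ (image α g F) ≡ image α g (∁ F)
  ∁-image g F = trans (sym (VecP.tabulate-∘ not (λ u → lookup F (act (g ⁻¹) u))))
                      (VecP.tabulate-cong (λ u → sym (lookup-∁ F (act (g ⁻¹) u))))

  ind-image : ∀ g F u k → ind (image α g F) u k ≡ ind F (act (g ⁻¹) u) k
  ind-image g F u k = cong (λ b → if b then k else 0) (lookup-image g F u)

  module _ (M : Mat n) (M-comm : CommutesWith α M) where

    -- CommutesWith speaks about rational functions; apply it to the indicator function of F.
    applyInd-image : ∀ g F u → applyInd M (image α g F) u ≡ applyInd M F (act (g ⁻¹) u)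
    applyInd-image g F u = ℕ→ℚ-injective (begin
      ℕ→ℚ (applyInd M (image α g F) u)
        ≡⟨ applyM-indicator (image α g F) u ⟨
      applyM M (indicator (image α g F)) u
        ≡⟨ sumℚ-cong (λ v → cong (λ b → ℕ→ℚ (M u v) ℚ.* ℕ→ℚ (if b then 1 else 0)) (lookup-image g F v)) ⟩
      applyM M (actFun α g (indicator F)) u
        ≡⟨ M-comm g (indicator F) u ⟩
      applyM M (indicator F) (act (g ⁻¹) u)
        ≡⟨ applyM-indicator F (act (g ⁻¹) u) ⟩
      ℕ→ℚ (applyInd M F (act (g ⁻¹) u)) ∎)
      where
      open ≡-Reasoning
      indicator : Subset n → Fin n → ℚ
      indicator F v = ℕ→ℚ (ind F v 1)
      applyM-indicator : ∀ F u → applyM M (indicator F) u ≡ ℕ→ℚ (applyInd M F u)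
      applyM-indicator F u = begin
        sumℚ (λ v → ℕ→ℚ (M u v) ℚ.* ℕ→ℚ (ind F v 1))
          ≡⟨ sumℚ-cong (λ v → ℕ→ℚ-* (M u v) (ind F v 1)) ⟨
        sumℚ (λ v → ℕ→ℚ (M u v * ind F v 1))
          ≡⟨ sumℚ-cong (λ v → cong ℕ→ℚ (ind≡M*𝟙 v)) ⟨
        sumℚ (λ v → ℕ→ℚ (ind F v (M u v)))
          ≡⟨ ℕ→ℚ-sumℕ (λ v → ind F v (M u v)) ⟨
        ℕ→ℚ (applyInd M F u) ∎
        where
        ind≡M*𝟙 : ∀ v → ind F v (M u v) ≡ M u v * ind F v 1
        ind≡M*𝟙 v = trans (cong (ind F v) (sym (ℕP.*-identityʳ (M u v)))) (ind-*ʳ F v (M u v) 1)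

    inner-image : ∀ g F H → inner M (image α g F) (image α g H) ≡ inner M F H
    inner-image g F H = begin
      sumℕ (λ u → ind (image α g H) u (applyInd M (image α g F) u))
        ≡⟨ sumℕ-cong (λ u → trans (cong (ind (image α g H) u) (applyInd-image g F u)) (ind-image g H u _)) ⟩
      sumℕ (λ u → ind H (act (g ⁻¹) u) (applyInd M F (act (g ⁻¹) u)))
        ≡⟨ sumℕ-act (g ⁻¹) (λ u → ind H u (applyInd M F u)) ⟨
      inner M F H ∎
      where open ≡-Reasoning

    cut-image : ∀ g A → cut M (image α g A) ≡ cut M A
    cut-image g A = trans (cong (inner M (image α g A)) (∁-image g A)) (inner-image g A (∁ A))

lemma4p7 : ∀ {c ℓ : Level} (n : ℕ) → 2 ≤ n →
  (d : ℕ) → 0 < d → (ρ : Fin d → Permutation′ n) →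
  let T = permSum ρ
      T² = T ∘M T
      dℚ = ℕ→ℚ d
  in SelfAdjoint T →
  (∀ u → vol T ⁅ u ⁆ ≡ d) →
  ¬ IsEigenvalue T ((- (+ d)) / 1) →
  (G : Group c ℓ) (α : Action G n) →
  Transitive α →
  CommutesWith α T² →
  ¬ TransitiveIndexTwoSubgroup α →
  (ψ hT : ℚ) → IsCheeger T² ψ → IsCheeger T hT →
  (A : Subset n) → Proper A →
  vol T² A ≤ vol T² (∁ A) →
  ℕ→ℚ (inner T² A (∁ A)) ≡ ψ ℚ.* ℕ→ℚ (vol T² A) →
  ψ ℚ.< hT /′ dℚ →
  (g : Group.Carrier G) →
  let κ = ((ℕ→ℚ 2 ℚ.* dℚ ℚ.* ψ) /′ (hT ℚ.* hT)) ℚ.* (1ℚ ℚ.+ hT)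
      volA = ℕ→ℚ (vol T A)
      volAgA = ℕ→ℚ (vol T (A ∩ image α g A))
  in (volA ℚ.* (1ℚ ℚ.- κ) ℚ.≤ volAgA) ⊎ (volAgA ℚ.≤ volA ℚ.* κ)
lemma4p7 _ _ d d>0 ρ T-sym vol⁅u⁆≡d _ G α _ T²-comm _ ψ hT ψ-cheeger hT-cheeger A (A≢∅ , _)
         vol²A≤vol²∁A cut²A≡ψvol²A ψ<hT/d g =
  overlap-dichotomy d>0 hT-cheeger (cheeger-nonNeg ψ-cheeger) A (image α g A) A≢∅
    vol²A≤vol²∁A cut²A≡ψvol²A ψ<hT/d (Invariance.cut-image α T² T²-comm g A)
  where
  T-regular : ∀ u → applyInd (permSum ρ) ⊤ u ≡ d
  T-regular u = trans (sym (vol-⁅⁆ (permSum ρ) u)) (vol⁅u⁆≡d u)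
  open Regular d (permSum ρ) T-sym T-regular
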